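{- For all integers $n\ge2$, $$G_{n}^{(s)}(m,r,s)=f(rs)\,G_{n-1}^{(s)}(m,rs,s)+rs\,G_{n-2}^{(s)}(m,rs^{2},s),$$ where $f(x)=1+x(m-1)$.
   Context: For an integer $n\ge0$ and a subset $S\subseteq\{1,\dots,n\}$, let $|S|$ be its size, $\sigma(S)=\sum_{i\in S}i$, and $c(S)$ the number of maximal runs of consecutive integers in $S$. Define $G_n^{(s)}(m,r,s)=\sum_{S\subseteq\{1,\dots,n\}} s^{\sigma(S)}r^{|S|}m^{c(S)}(m-1)^{|S|-c(S)}\in\mathbb{Z}[m,r,s]$ (the generating function of colored dimer configurations on a segment of size $n$, adjacent dimers having different colors, with $r$ counting dimers and $s$ recording the sum of positions). -}

module Defs where

open import Level using (Level)
open import Data.Bool using (Bool; true; false)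
open import Data.Nat using (ℕ; zero; suc) renaming (_+_ to _+ℕ_; _∸_ to _∸ℕ_)
open import Data.Vec using (Vec; []; _∷_)
open import Data.List using (List; []; _∷_; map; _++_; foldr)
open import Algebra.Bundles using (CommutativeRing; Semiring)
import Algebra.Definitions.RawSemiring as RS

-- A subset S of {1,…,n} is encoded as a Vec Bool n whose i-th entry
-- (0-based) is true iff the element i+1 belongs to S.

subsets : (n : ℕ) → List (Vec Bool n)
subsets zero = [] ∷ []
subsets (suc n) = map (false ∷_) (subsets n) ++ map (true ∷_) (subsets n)

card : ∀ {n} → Vec Bool n → ℕ
card [] = 0
card (false ∷ v) = card v
card (true ∷ v) = suc (card v)

-- sum of elements, where the first entry of the vector stands for the integer k
σFrom : ∀ {n} → ℕ → Vec Bool n → ℕ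
σFrom k [] = 0
σFrom k (false ∷ v) = σFrom (suc k) v
σFrom k (true ∷ v) = k +ℕ σFrom (suc k) v

σ : ∀ {n} → Vec Bool n → ℕ
σ = σFrom 1

-- number of maximal runs, given whether the previous element was in S:
-- a run starts at each element of S whose predecessor is not in S
runsAfter : ∀ {n} → Bool → Vec Bool n → ℕ
runsAfter p [] = 0
runsAfter p (false ∷ v) = runsAfter false v
runsAfter false (true ∷ v) = suc (runsAfter true v)
runsAfter true (true ∷ v) = runsAfter true v

runs : ∀ {n} → Vec Bool n → ℕ
runs = runsAfter false

module _ {c ℓ : Level} (R : CommutativeRing c ℓ) where
  open CommutativeRing R
  open RS (Semiring.rawSemiring semiring) using (_^_)

  pow : Carrier → ℕ → Carrier
  pow = _^_

  -- G_n^{(s)}(m,r,s) evaluated in the commutative ring R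
  -- (the exponent |S| - c(S) is natural since c(S) ≤ |S|; we use (|S| ∸ c(S))
  --  which coincides with it)
  G : ℕ → Carrier → Carrier → Carrier → Carrier
  G n m r s = foldr (λ S acc → term S + acc) 0# (subsets n)
    where
      term : Vec Bool n → Carrier
      term S = (s ^ σ S) * (r ^ card S) * (m ^ runs S)
               * ((m + (- 1#)) ^ (card S ∸ℕ runs S))

  f : Carrier → Carrier → Carrier
  f m x = 1# + x * (m + (- 1#))

-- Split the sum over S ⊆ {1,…,n} according to whether 1 ∈ S. Deleting 1 from S
-- and shifting the remaining elements down by one lowers σ(S) by |S|, which is
-- absorbed by replacing r with rs. If 1 ∈ S, split once more on 2 ∈ S: when
-- 2 ∉ S the element 1 forms a run of its own (factor rsm), when 2 ∈ S it
-- extends the run of 2 (factor rs(m-1)). Writing P and Q for the two halves of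
-- G_{n-1}(m,rs,s) so obtained, one gets G_n = (P + Q) + rsm P + rs(m-1) Q,
-- while P = G_{n-2}(m,rs²,s); the recurrence is a ring identity in P and Q.
module Submission where

open import Defs
open import Level using (Level)
open import Data.Nat using (ℕ; suc)
open import Algebra.Bundles using (CommutativeRing)

import Data.Nat as ℕ
import Data.Nat.Properties as ℕ
open import Data.Bool using (Bool; true; false)
open import Data.Vec using (Vec; []; _∷_)
open import Data.List using (List; []; _∷_; map; _++_; foldr)
open import Function using (_∘_)
open import Relation.Binary.PropositionalEquality as ≡ using (_≡_)

σFrom-suc : ∀ {n} k (v : Vec Bool n) → σFrom (suc k) v ≡ σFrom k v ℕ.+ card v
σFrom-suc k [] = ≡.refl
σFrom-suc k (false ∷ v) = σFrom-suc (suc k) v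
σFrom-suc k (true ∷ v) = begin
  suc k ℕ.+ σFrom (suc (suc k)) v           ≡⟨ ≡.cong (suc k ℕ.+_) (σFrom-suc (suc k) v) ⟩
  suc (k ℕ.+ (σFrom (suc k) v ℕ.+ card v))  ≡⟨ ≡.cong suc (≡.sym (ℕ.+-assoc k _ (card v))) ⟩
  suc (k ℕ.+ σFrom (suc k) v ℕ.+ card v)    ≡⟨ ≡.sym (ℕ.+-suc (k ℕ.+ σFrom (suc k) v) (card v)) ⟩
  k ℕ.+ σFrom (suc k) v ℕ.+ suc (card v)    ∎
  where open ≡.≡-Reasoning

runsAfter≤card : ∀ {n} b (v : Vec Bool n) → runsAfter b v ℕ.≤ card v
runsAfter≤card b [] = ℕ.z≤n
runsAfter≤card b (false ∷ v) = runsAfter≤card false v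
runsAfter≤card false (true ∷ v) = ℕ.s≤s (runsAfter≤card true v)
runsAfter≤card true (true ∷ v) = ℕ.m≤n⇒m≤1+n (runsAfter≤card true v)

module _ {c ℓ : Level} (R : CommutativeRing c ℓ) where
  open CommutativeRing R
  open import Algebra.Properties.CommutativeSemiring.Exp commutativeSemiring
    using (_^_; ^-congˡ; ^-congʳ; ^-homo-*; ^-distrib-*)
  open import Relation.Binary.Reasoning.Setoid setoid
  open import Algebra.Solver.Ring.NaturalCoefficients.Default commutativeSemiring
    using (solve; _:+_; _:*_; _:=_; con)
  open import Algebra.Properties.Group +-group using (//-rightDividesˡ)

  -- The solver is for commutative semirings, so m is first written as (m - 1) + 1.
  regroup : ∀ x m P Q → (P + Q) + (x * m * P + x * (m - 1#) * Q)
                       ≈ (1# + x * (m - 1#)) * (P + Q) + x * P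
  regroup x m P Q = begin
    (P + Q) + (x * m * P + x * (m - 1#) * Q)
      ≈⟨ +-congˡ (+-congʳ (*-congʳ (*-congˡ (sym (//-rightDividesˡ 1# m))))) ⟩
    (P + Q) + (x * ((m - 1#) + 1#) * P + x * (m - 1#) * Q)
      ≈⟨ solve 4 (λ x M P Q →
           (P :+ Q) :+ (x :* (M :+ con 1) :* P :+ x :* M :* Q)
             := (con 1 :+ x :* M) :* (P :+ Q) :+ x :* P) refl x (m - 1#) P Q ⟩
    (1# + x * (m - 1#)) * (P + Q) + x * P ∎

  Sum : ∀ {a} {A : Set a} → (A → Carrier) → List A → Carrier
  Sum f = foldr (λ x acc → f x + acc) 0#

  Sum-++ : ∀ {a} {A : Set a} (f : A → Carrier) xs ys →
           Sum f (xs ++ ys) ≈ Sum f xs + Sum f ys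
  Sum-++ f [] ys = sym (+-identityˡ _)
  Sum-++ f (x ∷ xs) ys = trans (+-congˡ (Sum-++ f xs ys)) (sym (+-assoc _ _ _))

  Sum-map : ∀ {a b} {A : Set a} {B : Set b} (f : B → Carrier) (g : A → B) xs →
            Sum f (map g xs) ≡ Sum (f ∘ g) xs
  Sum-map f g [] = ≡.refl
  Sum-map f g (x ∷ xs) = ≡.cong (f (g x) +_) (Sum-map f g xs)

  Sum-cong : ∀ {a} {A : Set a} {f g : A → Carrier} → (∀ x → f x ≈ g x) →
             ∀ xs → Sum f xs ≈ Sum g xs
  Sum-cong f≈g [] = refl
  Sum-cong f≈g (x ∷ xs) = +-cong (f≈g x) (Sum-cong f≈g xs)

  Sum-*ˡ : ∀ {a} {A : Set a} (c : Carrier) (f : A → Carrier) xs →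
           Sum (λ x → c * f x) xs ≈ c * Sum f xs
  Sum-*ˡ c f [] = sym (zeroʳ c)
  Sum-*ˡ c f (x ∷ xs) = trans (+-congˡ (Sum-*ˡ c f xs)) (sym (distribˡ c _ _))

  Sum-subsets-suc : ∀ n (f : Vec Bool (suc n) → Carrier) →
    Sum f (subsets (suc n)) ≈ Sum (f ∘ (false ∷_)) (subsets n) + Sum (f ∘ (true ∷_)) (subsets n)
  Sum-subsets-suc n f = trans (Sum-++ f (map (false ∷_) (subsets n)) _)
    (reflexive (≡.cong₂ _+_ (Sum-map f (false ∷_) (subsets n)) (Sum-map f (true ∷_) (subsets n))))

  module _ (m s : Carrier) where

    weight : ∀ {n} → Carrier → Vec Bool n → Carrier
    weight r S = s ^ σ S * r ^ card S * m ^ runs S * (m - 1#) ^ (card S ℕ.∸ runs S)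

    weight-cong : ∀ {n} {r r′} → r ≈ r′ → (S : Vec Bool n) → weight r S ≈ weight r′ S
    weight-cong r≈r′ S = *-congʳ (*-congʳ (*-congˡ (^-congˡ (card S) r≈r′)))

    shift-σ : ∀ {n} r (v : Vec Bool n) → s ^ σFrom 2 v * r ^ card v ≈ s ^ σ v * (r * s) ^ card v
    shift-σ r v = begin
      s ^ σFrom 2 v * r ^ card v              ≈⟨ *-congʳ (^-congʳ s (σFrom-suc 1 v)) ⟩
      s ^ (σ v ℕ.+ card v) * r ^ card v       ≈⟨ *-congʳ (^-homo-* s (σ v) (card v)) ⟩
      s ^ σ v * s ^ card v * r ^ card v       ≈⟨ *-assoc _ _ _ ⟩
      s ^ σ v * (s ^ card v * r ^ card v)     ≈⟨ *-congˡ (*-comm _ _) ⟩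
      s ^ σ v * (r ^ card v * s ^ card v)     ≈⟨ *-congˡ (sym (^-distrib-* r s (card v))) ⟩
      s ^ σ v * (r * s) ^ card v              ∎

    weight-false∷ : ∀ {n} r (v : Vec Bool n) → weight r (false ∷ v) ≈ weight (r * s) v
    weight-false∷ r v = *-congʳ (*-congʳ (shift-σ r v))

    weight-true∷false∷ : ∀ {n} r (v : Vec Bool n) →
      weight r (true ∷ false ∷ v) ≈ (r * s * m) * weight (r * s) (false ∷ v)
    weight-true∷false∷ r v = let u = false ∷ v in begin
      s * s ^ σFrom 2 u * (r * r ^ card u) * (m * m ^ runs u) * (m - 1#) ^ (card u ℕ.∸ runs u)
        ≈⟨ pull _ _ _ _ ⟩
      r * s * m * (s ^ σFrom 2 u * r ^ card u * m ^ runs u * (m - 1#) ^ (card u ℕ.∸ runs u))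
        ≈⟨ *-congˡ (*-congʳ (*-congʳ (shift-σ r u))) ⟩
      r * s * m * weight (r * s) u ∎
      where
      pull : ∀ A B C D → s * A * (r * B) * (m * C) * D ≈ r * s * m * (A * B * C * D)
      pull = solve 7 (λ s r m A B C D →
        s :* A :* (r :* B) :* (m :* C) :* D := r :* s :* m :* (A :* B :* C :* D)) refl s r m

    -- 1 joins the run of 2, so |S| − c(S) grows by one; truncated ∸ needs c(S) ≤ |S| here.
    weight-true∷true∷ : ∀ {n} r (v : Vec Bool n) →
      weight r (true ∷ true ∷ v) ≈ (r * s * (m - 1#)) * weight (r * s) (true ∷ v)
    weight-true∷true∷ r v = let u = true ∷ v in begin
      s * s ^ σFrom 2 u * (r * r ^ card u) * m ^ runs u * (m - 1#) ^ (suc (card v) ℕ.∸ runsAfter true v)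
        ≈⟨ *-congˡ (^-congʳ (m - 1#) (ℕ.+-∸-assoc 1 (runsAfter≤card true v))) ⟩
      s * s ^ σFrom 2 u * (r * r ^ card u) * m ^ runs u * ((m - 1#) * (m - 1#) ^ (card u ℕ.∸ runs u))
        ≈⟨ pull _ _ _ _ ⟩
      r * s * (m - 1#) * (s ^ σFrom 2 u * r ^ card u * m ^ runs u * (m - 1#) ^ (card u ℕ.∸ runs u))
        ≈⟨ *-congˡ (*-congʳ (*-congʳ (shift-σ r u))) ⟩
      r * s * (m - 1#) * weight (r * s) u ∎
      where
      pull : ∀ A B C D → s * A * (r * B) * C * ((m - 1#) * D) ≈ r * s * (m - 1#) * (A * B * C * D)
      pull = solve 7 (λ s r M A B C D →
        s :* A :* (r :* B) :* C :* (M :* D) := r :* s :* M :* (A :* B :* C :* D)) refl s r (m - 1#)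

    G-cong : ∀ n {r r′} → r ≈ r′ → G R n m r s ≈ G R n m r′ s
    G-cong n r≈r′ = Sum-cong (weight-cong r≈r′) (subsets n)

    G-suc : ∀ n r → G R (suc n) m r s ≈
      Sum (weight r ∘ (false ∷_)) (subsets n) + Sum (weight r ∘ (true ∷_)) (subsets n)
    G-suc n r = Sum-subsets-suc n (weight r)

    Sum-false∷ : ∀ n r → Sum (weight r ∘ (false ∷_)) (subsets n) ≈ G R n m (r * s) s
    Sum-false∷ n r = Sum-cong (weight-false∷ r) (subsets n)

    Sum-true∷ : ∀ n r → Sum (weight r ∘ (true ∷_)) (subsets (suc n)) ≈
      (r * s * m) * Sum (weight (r * s) ∘ (false ∷_)) (subsets n)
        + (r * s * (m - 1#)) * Sum (weight (r * s) ∘ (true ∷_)) (subsets n)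
    Sum-true∷ n r = trans (Sum-subsets-suc n (weight r ∘ (true ∷_))) (+-cong
      (trans (Sum-cong (weight-true∷false∷ r) (subsets n)) (Sum-*ˡ (r * s * m) _ (subsets n)))
      (trans (Sum-cong (weight-true∷true∷ r) (subsets n)) (Sum-*ˡ (r * s * (m - 1#)) _ (subsets n))))

mainTheorem4 : ∀ {c ℓ : Level} (R : CommutativeRing c ℓ) (k : ℕ) →
    let open CommutativeRing R in
    ∀ (m r s : Carrier) →
    G R (suc (suc k)) m r s
    ≈ f R m (r * s) * G R (suc k) m (r * s) s
    + (r * s) * G R k m (r * pow R s 2) s
mainTheorem4 R k m r s = begin
  G R (suc (suc k)) m r s
    ≈⟨ trans (G-suc R m s (suc k) r) (+-cong (Sum-false∷ R m s (suc k) r) (Sum-true∷ R m s k r)) ⟩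
  G R (suc k) m (r * s) s + ((r * s * m) * P + (r * s * (m - 1#)) * Q)
    ≈⟨ +-congʳ (G-suc R m s k (r * s)) ⟩
  (P + Q) + ((r * s * m) * P + (r * s * (m - 1#)) * Q)
    ≈⟨ regroup R (r * s) m P Q ⟩
  f R m (r * s) * (P + Q) + (r * s) * P
    ≈⟨ +-cong (*-congˡ (sym (G-suc R m s k (r * s)))) (*-congˡ P≈G) ⟩
  f R m (r * s) * G R (suc k) m (r * s) s + (r * s) * G R k m (r * pow R s 2) s ∎
  where
  open CommutativeRing R
  open import Relation.Binary.Reasoning.Setoid setoid

  P Q : Carrier
  P = Sum R (weight R m s (r * s) ∘ (false ∷_)) (subsets k)
  Q = Sum R (weight R m s (r * s) ∘ (true ∷_)) (subsets k)

  P≈G : P ≈ G R k m (r * pow R s 2) s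
  P≈G = trans (Sum-false∷ R m s k (r * s))
              (G-cong R m s k (trans (*-assoc r s s) (*-congˡ (*-congˡ (sym (*-identityʳ s))))))
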